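{- For each integer $n\geq 3$, $\operatorname{tww}(J(n,2))\leq 2(n-3)$.
   Context: The Johnson graph $J(n,2)$ has vertex set the $2$-element subsets of $\{1,\dots,n\}$, two distinct vertices $S,S'$ being adjacent iff $|S\cap S'|=1$. A trigraph is a graph whose edges are colored red or black; a graph is a trigraph with all edges black. For a partition $\mathcal{P}$ of $V(G)$, the quotient trigraph $G/\mathcal{P}$ has vertex set $\mathcal{P}$; two parts $U,W$ are joined by a black edge if every pair $u\in U,w\in W$ is a black edge, are non-adjacent if no such pair is an edge, and are joined by a red edge otherwise. A contraction sequence of an $N$-vertex trigraph $G$ is a sequence $\mathcal{P}_N,\dots,\mathcal{P}_1$ of partitions with $\mathcal{P}_N$ discrete and each $\mathcal{P}_i$ obtained from $\mathcal{P}_{i+1}$ by merging two parts; its width is the maximum red degree over all $G/\mathcal{P}_i$; $\operatorname{tww}(G)$ is the minimum width. -}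

module Defs where

open import Data.Bool using (Bool; true; false; not; _∧_; _∨_; if_then_else_; T)
open import Data.Nat using (ℕ; zero; suc; _≤_; _<_; _≡ᵇ_)
open import Data.Fin using (Fin; _≟_; _<?_)
open import Data.List using (List; []; _∷_; [_]; length; filterᵇ; allFin; foldr; concatMap; lookup)
open import Data.Product using (_×_; _,_; Σ; ∃; proj₁; proj₂)
open import Data.Sum using (_⊎_)
open import Function using (Injective; Surjective)
open import Relation.Binary.PropositionalEquality using (_≡_)
open import Relation.Nullary using (¬_)
open import Relation.Nullary.Decidable using (⌊_⌋)

record Graph : Set where
  field
    N   : ℕ
    adj : Fin N → Fin N → Bool

open Graph public

allB : {A : Set} → (A → Bool) → List A → Bool
allB p = foldr (λ x r → p x ∧ r) true

-- Partitions of Fin N into exactly m parts, given as a surjective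
-- labelling  P : Fin N → Fin m  (part of u = label P u).

module _ (G : Graph) where

  -- Quotient trigraph G/P, for P : Fin (N G) → Fin m.
  -- The parts labelled a and b are joined by a black edge iff every pair
  -- u ∈ a, w ∈ b is an edge; non-adjacent iff no such pair is an edge.
  blackEdge : ∀ {m} → (Fin (N G) → Fin m) → Fin m → Fin m → Bool
  blackEdge P a b =
    allB (λ u → allB (λ w → not (⌊ P u ≟ a ⌋ ∧ ⌊ P w ≟ b ⌋) ∨ adj G u w)
                   (allFin (N G)))
        (allFin (N G))

  nonAdjacent : ∀ {m} → (Fin (N G) → Fin m) → Fin m → Fin m → Bool
  nonAdjacent P a b =
    allB (λ u → allB (λ w → not (⌊ P u ≟ a ⌋ ∧ ⌊ P w ≟ b ⌋) ∨ not (adj G u w))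
                   (allFin (N G)))
        (allFin (N G))

  redEdge : ∀ {m} → (Fin (N G) → Fin m) → Fin m → Fin m → Bool
  redEdge P a b = not ⌊ a ≟ b ⌋ ∧ not (blackEdge P a b) ∧ not (nonAdjacent P a b)

  redDegree : ∀ {m} → (Fin (N G) → Fin m) → Fin m → ℕ
  redDegree {m} P a = length (filterᵇ (redEdge P a) (allFin m))

  -- A contraction sequence P_N, ..., P_1 : the partition P_i (i = k+1 parts)
  -- is the labelling  Seq k : Fin N → Fin (suc k), for k < N.
  record ContractionSequence : Set where
    field
      Seq : (k : ℕ) → Fin (N G) → Fin (suc k)
      parts : ∀ k → suc k ≤ N G → Surjective _≡_ _≡_ (Seq k)
      discrete : ∀ k → suc k ≡ N G → Injective _≡_ _≡_ (Seq k)
      -- P_i is obtained from P_{i+1} by merging two (distinct) parts a, b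
      merge : ∀ k → suc (suc k) ≤ N G →
        Σ (Fin (suc (suc k))) λ a → Σ (Fin (suc (suc k))) λ b → ¬ (a ≡ b) ×
          (∀ u v → (Seq k u ≡ Seq k v →
                      (Seq (suc k) u ≡ Seq (suc k) v) ⊎
                      ((Seq (suc k) u ≡ a ⊎ Seq (suc k) u ≡ b) ×
                       (Seq (suc k) v ≡ a ⊎ Seq (suc k) v ≡ b)))
                 × ((Seq (suc k) u ≡ Seq (suc k) v) ⊎
                      ((Seq (suc k) u ≡ a ⊎ Seq (suc k) u ≡ b) ×
                       (Seq (suc k) v ≡ a ⊎ Seq (suc k) v ≡ b))
                    → Seq k u ≡ Seq k v))

  open ContractionSequence public

  WidthAtMost : ContractionSequence → ℕ → Set
  WidthAtMost S w = ∀ k → suc k ≤ N G → ∀ (a : Fin (suc k)) → redDegree (Seq S k) a ≤ w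

  TwwAtMost : ℕ → Set
  TwwAtMost w = Σ ContractionSequence λ S → WidthAtMost S w

-- Johnson graph J(n,2).  Vertices: the 2-subsets {i,j}, i < j, of Fin n,
-- enumerated in a fixed list; vertex k of J(n,2) is the k-th entry.

pairs : (n : ℕ) → List (Fin n × Fin n)
pairs n = concatMap (λ i → concatMap (λ j → if ⌊ i <? j ⌋ then [ (i , j) ] else [])
                                      (allFin n))
                    (allFin n)

mem2 : ∀ {n} → Fin n → Fin n × Fin n → Bool
mem2 x (i , j) = ⌊ x ≟ i ⌋ ∨ ⌊ x ≟ j ⌋

interSize : ∀ {n} → Fin n × Fin n → Fin n × Fin n → ℕ
interSize {n} S S' = length (filterᵇ (λ x → mem2 x S ∧ mem2 x S') (allFin n))

Johnson2 : ℕ → Graph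
Johnson2 n = record
  { N = length (pairs n)
  ; adj = λ u v → interSize (lookup (pairs n) u) (lookup (pairs n) v) ≡ᵇ 1
  }

module Submission where

-- Write the 2-subset {c, x}, c < x, as the pair (c, x).  The contraction sequence
-- identifies the element 0 with 1, then 1 with 2, and so on: row by row, each (c, x)
-- with x ≥ c + 2 is merged into (c + 1, x), and finally (c, c + 1) into (c + 1, c + 2),
-- so that every part is named by a surviving pair.  While row i is being processed, a
-- part named by a pair in a row ≥ i + 2 (or by (0, 1)) is still a single vertex, and
-- replacing a merged pair by its parent never changes adjacency to it; so it has no red
-- edge.  Red edges therefore only join parts named in rows i and i + 1, and there are
-- at most 2(n − 3) + 1 of those once (0, 1) and (0, 2) are left out for i = 0.

open import Defs
open import Data.Bool using (Bool; true; false; not; _∧_; _∨_; if_then_else_)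
open import Data.Bool.Properties using (∧-distribʳ-∨; ∧-zeroʳ; T-≡; not-injective)
open import Data.Nat using (ℕ; zero; suc; _+_; _*_; _∸_; _≤_; _<_; _≡ᵇ_; z≤n; s≤s; s≤s⁻¹)
open import Data.Nat.Properties
  using (+-mono-≤; +-monoˡ-≤; +-monoʳ-≤; +-suc; +-comm; +-identityʳ; +-cancelˡ-≡;
         ≤-trans; ≤-reflexive; ≤-antisym; ≤-pred; <-≤-trans; ≤-<-trans; <-trans; <-irrefl; <-cmp;
         <⇒≤; <⇒≢; <⇒≱; ≰⇒>; ≮⇒≥; ≤∧≢⇒<; m≤n⇒m<n∨m≡n; m≤m+n; n<1+n; 1+n≰n; _≤?_;
         ∸-monoʳ-≤; ∸-monoˡ-≤; ∸-monoˡ-<; ∸-cancelˡ-≡; ∸-cancelʳ-≡; m>n⇒m∸n≢0; m≤n⇒m∸n≡0;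
         module ≤-Reasoning; +-commutativeSemigroup)
  renaming (_≟_ to _≟ℕ_; _<?_ to _<ℕ?_)
open import Data.Fin as Fin using (Fin; toℕ; _≟_; _<?_; punchOut)
open import Data.Fin.Properties
  using (toℕ-injective; suc-injective; toℕ-fromℕ<; toℕ-fromℕ; fromℕ<-injective; toℕ<n;
         injective⇒≤; any?; punchOut-injective)
open import Data.List using (List; []; _∷_; [_]; _++_; map; length; allFin; concatMap; filterᵇ; lookup)
open import Data.List.Properties
  using (map-tabulate; concatMap-cong; concatMap-map; map-concatMap; concatMap-pure; filter-none;
         length-++; length-map; length-tabulate)
open import Data.List.Relation.Unary.All as All using (All)
import Data.List.Relation.Unary.All.Properties as All
open import Data.List.Relation.Unary.Any using (here; there)
open import Data.List.Relation.Unary.Unique.Propositional using (Unique)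
import Data.List.Relation.Unary.AllPairs as AllPairs
import Data.List.Relation.Unary.Unique.Propositional.Properties as Unique
open import Data.List.Membership.Propositional using (_∈_; _∉_)
open import Data.List.Membership.Propositional.Properties using (∈-allFin; ∈-map⁻; ∈-lookup; ∈-filter⁻)
open import Data.Product using (Σ; _×_; _,_; proj₁; proj₂; ∃)
open import Data.Sum using (_⊎_; inj₁; inj₂; [_,_]′)
open import Data.Empty using (⊥-elim)
open import Function using (_∘_; id; Surjective)
open import Function.Bundles using (Equivalence)
open import Relation.Binary.PropositionalEquality hiding ([_])
open import Algebra.Properties.CommutativeSemigroup +-commutativeSemigroup using (interchange)
open import Relation.Binary using (tri<; tri≈; tri>)
open import Relation.Nullary using (Dec; yes; no; ¬_)
open import Relation.Nullary.Decidable using (⌊_⌋; T?)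

private variable
  A B : Set
  a b m : ℕ

triangle : ℕ → ℕ
triangle zero    = 0
triangle (suc m) = suc m + triangle m

triangle-mono-≤ : a ≤ b → triangle a ≤ triangle b
triangle-mono-≤ z≤n       = z≤n
triangle-mono-≤ (s≤s a≤b) = s≤s (+-mono-≤ a≤b (triangle-mono-≤ a≤b))

⌊⌋-cong : {P Q : Set} → (P → Q) → (Q → P) → (p? : Dec P) (q? : Dec Q) → ⌊ p? ⌋ ≡ ⌊ q? ⌋
⌊⌋-cong to from (yes p) (yes q) = refl
⌊⌋-cong to from (no ¬p) (no ¬q) = refl
⌊⌋-cong to from (yes p) (no ¬q) = ⊥-elim (¬q (to p))
⌊⌋-cong to from (no ¬p) (yes q) = ⊥-elim (¬p (from q))

⌊⌋-true : {P : Set} (p? : Dec P) → P → ⌊ p? ⌋ ≡ true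
⌊⌋-true (yes _) _ = refl
⌊⌋-true (no ¬p) p = ⊥-elim (¬p p)

⌊⌋-false : {P : Set} (p? : Dec P) → ¬ P → ⌊ p? ⌋ ≡ false
⌊⌋-false (yes p) ¬p = ⊥-elim (¬p p)
⌊⌋-false (no _)  _  = refl

⌊⌋≡true⇒ : {P : Set} (p? : Dec P) → ⌊ p? ⌋ ≡ true → P
⌊⌋≡true⇒ (yes p) _ = p

∸-suc : a < b → b ∸ a ≡ suc (b ∸ suc a)
∸-suc {zero}  {suc b} _         = refl
∸-suc {suc a} {suc b} (s≤s a<b) = ∸-suc a<b

∸2+∸4≡2*∸3 : 3 < a → (a ∸ 2) + (a ∸ 4) ≡ 2 * (a ∸ 3)
∸2+∸4≡2*∸3 {suc (suc (suc (suc a)))} (s≤s (s≤s (s≤s (s≤s _)))) =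
  cong suc (trans (+-comm (suc a) a) (cong (λ b → a + suc b) (sym (+-identityʳ a))))

-- The enumeration of 2-subsets

pairsFrom : ∀ {n} → Fin n → List (Fin n × Fin n)
pairsFrom {n} i = concatMap (λ j → if ⌊ i <? j ⌋ then [ (i , j) ] else []) (allFin n)

shiftPair : ∀ {n} → Fin n × Fin n → Fin (suc n) × Fin (suc n)
shiftPair (i , j) = Fin.suc i , Fin.suc j

pairsFromZero : ∀ m → List (Fin (suc m) × Fin (suc m))
pairsFromZero m = map (λ j → Fin.zero , Fin.suc j) (allFin m)

allFin-suc : ∀ m → allFin (suc m) ≡ Fin.zero ∷ map Fin.suc (allFin m)
allFin-suc m = cong (Fin.zero ∷_) (sym (map-tabulate id Fin.suc))

concatMap-singleton : (f : A → B) (xs : List A) → concatMap (λ x → [ f x ]) xs ≡ map f xs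
concatMap-singleton f xs = trans (sym (concatMap-map [_] f xs)) (concatMap-pure (map f xs))

map-if : (f : A → B) (c : Bool) (x : A) →
         map f (if c then [ x ] else []) ≡ (if c then [ f x ] else [])
map-if f true  x = refl
map-if f false x = refl

pairsFrom-zero : ∀ m → pairsFrom {suc m} Fin.zero ≡ pairsFromZero m
pairsFrom-zero m = begin
  concatMap row (allFin (suc m))
    ≡⟨ cong (concatMap row) (allFin-suc m) ⟩
  concatMap row (map Fin.suc (allFin m))
    ≡⟨ concatMap-map row Fin.suc (allFin m) ⟩
  concatMap (row ∘ Fin.suc) (allFin m)
    ≡⟨ concatMap-cong (λ j → cong (λ c → if c then [ (Fin.zero , Fin.suc j) ] else [])
                                  (⌊⌋-true (Fin.zero {m} <? Fin.suc j) (s≤s z≤n)))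
                      (allFin m) ⟩
  concatMap (λ j → [ (Fin.zero , Fin.suc j) ]) (allFin m)
    ≡⟨ concatMap-singleton (λ j → Fin.zero , Fin.suc j) (allFin m) ⟩
  pairsFromZero m ∎
  where
  open ≡-Reasoning
  row : Fin (suc m) → List (Fin (suc m) × Fin (suc m))
  row j = if ⌊ Fin.zero {m} <? j ⌋ then [ (Fin.zero , j) ] else []

pairsFrom-suc : ∀ {m} (i : Fin m) → pairsFrom (Fin.suc i) ≡ map shiftPair (pairsFrom i)
pairsFrom-suc {m} i = begin
  concatMap row (allFin (suc m))
    ≡⟨ cong (concatMap row) (allFin-suc m) ⟩
  row Fin.zero ++ concatMap row (map Fin.suc (allFin m))
    ≡⟨ cong₂ _++_ (cong (λ c → if c then [ (Fin.suc i , Fin.zero) ] else [])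
                        (⌊⌋-false (Fin.suc i <? Fin.zero {m}) λ ()))
                  (concatMap-map row Fin.suc (allFin m)) ⟩
  concatMap (row ∘ Fin.suc) (allFin m)
    ≡⟨ concatMap-cong (λ j → trans (cong (λ c → if c then [ (Fin.suc i , Fin.suc j) ] else [])
                                         (⌊⌋-cong s≤s⁻¹ s≤s (Fin.suc i <? Fin.suc j) (i <? j)))
                                   (sym (map-if shiftPair ⌊ i <? j ⌋ (i , j))))
                      (allFin m) ⟩
  concatMap (map shiftPair ∘ row′) (allFin m)
    ≡⟨ map-concatMap shiftPair row′ (allFin m) ⟨
  map shiftPair (pairsFrom i) ∎
  where
  open ≡-Reasoning
  row : Fin (suc m) → List (Fin (suc m) × Fin (suc m))
  row j = if ⌊ Fin.suc i <? j ⌋ then [ (Fin.suc i , j) ] else []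
  row′ : Fin m → List (Fin m × Fin m)
  row′ j = if ⌊ i <? j ⌋ then [ (i , j) ] else []

pairs-suc : ∀ m → pairs (suc m) ≡ pairsFromZero m ++ map shiftPair (pairs m)
pairs-suc m = begin
  concatMap pairsFrom (allFin (suc m))
    ≡⟨ cong (concatMap pairsFrom) (allFin-suc m) ⟩
  pairsFrom Fin.zero ++ concatMap pairsFrom (map Fin.suc (allFin m))
    ≡⟨ cong₂ _++_ (pairsFrom-zero m) (concatMap-map pairsFrom Fin.suc (allFin m)) ⟩
  pairsFromZero m ++ concatMap (pairsFrom ∘ Fin.suc) (allFin m)
    ≡⟨ cong (pairsFromZero m ++_) (concatMap-cong pairsFrom-suc (allFin m)) ⟩
  pairsFromZero m ++ concatMap (map shiftPair ∘ pairsFrom) (allFin m)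
    ≡⟨ cong (pairsFromZero m ++_) (map-concatMap shiftPair pairsFrom (allFin m)) ⟨
  pairsFromZero m ++ map shiftPair (pairs m) ∎
  where open ≡-Reasoning

pairs-ordered : ∀ n → All (λ (i , j) → i Fin.< j) (pairs n)
pairs-ordered zero = All.[]
pairs-ordered (suc m) rewrite pairs-suc m =
  All.++⁺ (All.map⁺ (All.universal (λ _ → s≤s z≤n) (allFin m)))
          (All.map⁺ (All.map s≤s (pairs-ordered m)))

shiftPair-injective : ∀ {m} {p q : Fin m × Fin m} → shiftPair p ≡ shiftPair q → p ≡ q
shiftPair-injective {p = _ , _} {_ , _} refl = refl

pairs-unique : ∀ n → Unique (pairs n)
pairs-unique zero = AllPairs.[]
pairs-unique (suc m) rewrite pairs-suc m =
  Unique.++⁺ (Unique.map⁺ (λ e → suc-injective (cong proj₂ e)) (Unique.allFin⁺ m))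
             (Unique.map⁺ shiftPair-injective (pairs-unique m))
             disjoint
  where
  disjoint : ∀ {p} → ¬ (p ∈ pairsFromZero m × p ∈ map shiftPair (pairs m))
  disjoint (p∈zero , p∈shift) with ∈-map⁻ _ p∈zero | ∈-map⁻ shiftPair p∈shift
  ... | _ , _ , refl | _ , _ , ()

length-pairs : ∀ m → length (pairs (suc m)) ≡ triangle m
length-pairs zero    = refl
length-pairs (suc m) = begin
  length (pairs (suc (suc m)))
    ≡⟨ cong length (pairs-suc (suc m)) ⟩
  length (pairsFromZero (suc m) ++ map shiftPair (pairs (suc m)))
    ≡⟨ length-++ (pairsFromZero (suc m)) ⟩
  length (pairsFromZero (suc m)) + length (map shiftPair (pairs (suc m)))
    ≡⟨ cong₂ _+_ (trans (length-map _ (allFin (suc m))) (length-tabulate id))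
                 (trans (length-map shiftPair (pairs (suc m))) (length-pairs m)) ⟩
  triangle (suc m) ∎
  where open ≡-Reasoning

-- Sizes of intersections of 2-subsets

bit : Bool → ℕ
bit true  = 1
bit false = 0

count : (A → Bool) → List A → ℕ
count p xs = length (filterᵇ p xs)

count-cong : {p q : A → Bool} → (∀ x → p x ≡ q x) → ∀ xs → count p xs ≡ count q xs
count-cong {p = p} {q} p≗q []       = refl
count-cong {p = p} {q} p≗q (x ∷ xs) with p x | q x | p≗q x
... | true  | true  | refl = cong suc (count-cong p≗q xs)
... | false | false | refl = count-cong p≗q xs

count-∨ : {p q : A → Bool} → (∀ x → p x ∧ q x ≡ false) → ∀ xs →
          count (λ x → p x ∨ q x) xs ≡ count p xs + count q xs
count-∨ {p = p} {q} disjoint []       = refl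
count-∨ {p = p} {q} disjoint (x ∷ xs) with p x | q x | disjoint x
... | true  | false | _ = cong suc (count-∨ disjoint xs)
... | false | true  | _ = trans (cong suc (count-∨ disjoint xs)) (sym (+-suc _ _))
... | false | false | _ = count-∨ disjoint xs

count-at-∉ : ∀ {n} (a : Fin n) (Q : Fin n → Bool) xs → a ∉ xs →
             count (λ x → ⌊ x ≟ a ⌋ ∧ Q x) xs ≡ 0
count-at-∉ a Q []       a∉xs = refl
count-at-∉ a Q (x ∷ xs) a∉xs with x ≟ a
... | yes refl = ⊥-elim (a∉xs (here refl))
... | no _     = count-at-∉ a Q xs (a∉xs ∘ there)

count-at-∈ : ∀ {n} (a : Fin n) (Q : Fin n → Bool) xs → Unique xs → a ∈ xs →
             count (λ x → ⌊ x ≟ a ⌋ ∧ Q x) xs ≡ bit (Q a)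
count-at-∈ a Q (x ∷ xs) (x∉xs AllPairs.∷ _) (here refl) with x ≟ x | Q x
... | no x≢x | _     = ⊥-elim (x≢x refl)
... | yes _  | true  = cong suc (count-at-∉ a Q xs (λ a∈xs → All.lookup x∉xs a∈xs refl))
... | yes _  | false = count-at-∉ a Q xs (λ a∈xs → All.lookup x∉xs a∈xs refl)
count-at-∈ a Q (x ∷ xs) (x∉xs AllPairs.∷ unique) (there a∈xs) with x ≟ a
... | yes refl = ⊥-elim (All.lookup x∉xs a∈xs refl)
... | no _     = count-at-∈ a Q xs unique a∈xs

count-at-pair : ∀ {n} (a b : Fin n) (Q : Fin n → Bool) → a ≢ b →
  count (λ x → (⌊ x ≟ a ⌋ ∨ ⌊ x ≟ b ⌋) ∧ Q x) (allFin n) ≡ bit (Q a) + bit (Q b)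
count-at-pair {n} a b Q a≢b = begin
  count (λ x → (⌊ x ≟ a ⌋ ∨ ⌊ x ≟ b ⌋) ∧ Q x) (allFin n)
    ≡⟨ count-cong (λ x → ∧-distribʳ-∨ (Q x) ⌊ x ≟ a ⌋ ⌊ x ≟ b ⌋) (allFin n) ⟩
  count (λ x → (⌊ x ≟ a ⌋ ∧ Q x) ∨ (⌊ x ≟ b ⌋ ∧ Q x)) (allFin n)
    ≡⟨ count-∨ disjoint (allFin n) ⟩
  count (λ x → ⌊ x ≟ a ⌋ ∧ Q x) (allFin n) + count (λ x → ⌊ x ≟ b ⌋ ∧ Q x) (allFin n)
    ≡⟨ cong₂ _+_ (count-at-∈ a Q (allFin n) (Unique.allFin⁺ n) (∈-allFin a))
                 (count-at-∈ b Q (allFin n) (Unique.allFin⁺ n) (∈-allFin b)) ⟩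
  bit (Q a) + bit (Q b) ∎
  where
  open ≡-Reasoning
  disjoint : ∀ x → (⌊ x ≟ a ⌋ ∧ Q x) ∧ (⌊ x ≟ b ⌋ ∧ Q x) ≡ false
  disjoint x with x ≟ a | x ≟ b
  ... | yes refl | yes refl = ⊥-elim (a≢b refl)
  ... | yes _    | no _     = ∧-zeroʳ _
  ... | no _     | _        = refl

-- Opaque, so that `rewrite` and `with` see δ-terms instead of their unfolding.
opaque
  δ : ℕ → ℕ → ℕ
  δ x y = bit ⌊ x ≟ℕ y ⌋

  δ-refl : ∀ a → δ a a ≡ 1
  δ-refl a = cong bit (⌊⌋-true (a ≟ℕ a) refl)

  δ-sym : ∀ a b → δ a b ≡ δ b a
  δ-sym a b = cong bit (⌊⌋-cong sym sym (a ≟ℕ b) (b ≟ℕ a))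

  δ-< : a < b → δ a b ≡ 0
  δ-< {a} {b} a<b = cong bit (⌊⌋-false (a ≟ℕ b) (<⇒≢ a<b))

  bit-mem2 : ∀ {n} (x c d : Fin n) → c ≢ d →
             bit (mem2 x (c , d)) ≡ δ (toℕ x) (toℕ c) + δ (toℕ x) (toℕ d)
  bit-mem2 x c d c≢d
    rewrite ⌊⌋-cong (cong toℕ) toℕ-injective (x ≟ c) (toℕ x ≟ℕ toℕ c)
          | ⌊⌋-cong (cong toℕ) toℕ-injective (x ≟ d) (toℕ x ≟ℕ toℕ d)
    with toℕ x ≟ℕ toℕ c | toℕ x ≟ℕ toℕ d
  ... | yes x≡c | yes x≡d = ⊥-elim (c≢d (toℕ-injective (trans (sym x≡c) x≡d)))
  ... | yes _   | no _    = refl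
  ... | no _    | yes _   = refl
  ... | no _    | no _    = refl

interSize-formula : ∀ {n} (a b c d : Fin n) → a ≢ b → c ≢ d →
  interSize (a , b) (c , d) ≡
  (δ (toℕ a) (toℕ c) + δ (toℕ a) (toℕ d)) + (δ (toℕ b) (toℕ c) + δ (toℕ b) (toℕ d))
interSize-formula a b c d a≢b c≢d =
  trans (count-at-pair a b (λ x → mem2 x (c , d)) a≢b)
        (cong₂ _+_ (bit-mem2 a c d c≢d) (bit-mem2 b c d c≢d))

-- Red edges and red degrees

lookup-injective : (xs : List A) → Unique xs → ∀ i j → lookup xs i ≡ lookup xs j → i ≡ j
lookup-injective (x ∷ xs) _                    Fin.zero    Fin.zero    _  = refl
lookup-injective (x ∷ xs) (x∉xs AllPairs.∷ _)  Fin.zero    (Fin.suc j) eq =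
  ⊥-elim (All.lookup x∉xs (∈-lookup j) eq)
lookup-injective (x ∷ xs) (x∉xs AllPairs.∷ _)  (Fin.suc i) Fin.zero    eq =
  ⊥-elim (All.lookup x∉xs (∈-lookup i) (sym eq))
lookup-injective (x ∷ xs) (_ AllPairs.∷ unique) (Fin.suc i) (Fin.suc j) eq =
  cong Fin.suc (lookup-injective xs unique i j eq)

length-≤-by-code : ∀ {P : A → Set} {M} (xs : List A) → Unique xs → All P xs →
                   (code : ∀ {x} → P x → ℕ) →
                   (∀ {x y} (px : P x) (py : P y) → code px ≡ code py → x ≡ y) →
                   (∀ {x} (px : P x) → code px < M) → length xs ≤ M
length-≤-by-code {P = P} {M} xs unique all code code-injective code-< = injective⇒≤ {f = f} f-injective
  where
  P-at : ∀ i → P (lookup xs i)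
  P-at i = All.lookup all (∈-lookup i)
  f : Fin (length xs) → Fin M
  f i = Fin.fromℕ< (code-< (P-at i))
  f-injective : ∀ {i j} → f i ≡ f j → i ≡ j
  f-injective {i} {j} eq = lookup-injective xs unique i j (code-injective (P-at i) (P-at j)
    (trans (sym (toℕ-fromℕ< (code-< (P-at i)))) (trans (cong toℕ eq) (toℕ-fromℕ< (code-< (P-at j))))))

count-≤-by-code : ∀ {m M} (p : Fin m → Bool) (a : Fin m) → p a ≡ false →
                  {P : Fin m → Set} → P a → (∀ b → p b ≡ true → P b) →
                  (code : ∀ {x} → P x → ℕ) →
                  (∀ {x y} (px : P x) (py : P y) → code px ≡ code py → x ≡ y) →
                  (∀ {x} (px : P x) → code px ≤ M) → count p (allFin m) ≤ M
count-≤-by-code {m} p a pa≡false Pa p⇒P code code-injective code-≤ =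
  ≤-pred (length-≤-by-code (a ∷ filterᵇ p (allFin m))
    (All.tabulate a≢ AllPairs.∷ Unique.filter⁺ (T? ∘ p) (Unique.allFin⁺ m))
    (Pa All.∷ All.tabulate (λ b∈ → p⇒P _ (∈-filter⇒ b∈)))
    code code-injective (s≤s ∘ code-≤))
  where
  ∈-filter⇒ : ∀ {b} → b ∈ filterᵇ p (allFin m) → p b ≡ true
  ∈-filter⇒ b∈ = Equivalence.to T-≡ (proj₂ (∈-filter⁻ (T? ∘ p) {xs = allFin m} b∈))
  a≢ : ∀ {b} → b ∈ filterᵇ p (allFin m) → a ≢ b
  a≢ b∈ refl with () ← trans (sym pa≡false) (∈-filter⇒ b∈)

allB-false : (p : A → Bool) (xs : List A) → allB p xs ≡ false → ∃ λ x → p x ≡ false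
allB-false p (x ∷ xs) eq with p x in px
... | false = x , px
... | true  = allB-false p xs eq

not-∧∨-false : ∀ x y z → not (x ∧ y) ∨ z ≡ false → x ≡ true × y ≡ true × z ≡ false
not-∧∨-false true true false _ = refl , refl , refl

∧-not-not-true : ∀ x y z → x ∧ not y ∧ not z ≡ true → y ≡ false × z ≡ false
∧-not-not-true true false false _ = refl , refl

module _ (G : Graph) {m} (P : Fin (N G) → Fin m) where

  record Mixed (a b : Fin m) : Set where
    field
      {u u′ w w′} : Fin (N G)
      u∈a  : P u ≡ a
      u′∈a : P u′ ≡ a
      w∈b  : P w ≡ b
      w′∈b : P w′ ≡ b
      edge     : adj G u w ≡ true
      non-edge : adj G u′ w′ ≡ false

  private
    pair-witness : ∀ {a b} (q : Fin (N G) → Fin (N G) → Bool) →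
      allB (λ u → allB (λ w → not (⌊ P u ≟ a ⌋ ∧ ⌊ P w ≟ b ⌋) ∨ q u w) (allFin (N G))) (allFin (N G)) ≡ false →
      ∃ λ u → ∃ λ w → P u ≡ a × P w ≡ b × q u w ≡ false
    pair-witness {a} {b} q eq with allB-false _ (allFin (N G)) eq
    ... | u , inner with allB-false _ (allFin (N G)) inner
    ...   | w , entry with not-∧∨-false ⌊ P u ≟ a ⌋ ⌊ P w ≟ b ⌋ (q u w) entry
    ...     | u∈a , w∈b , q≡false = u , w , ⌊⌋≡true⇒ (P u ≟ a) u∈a , ⌊⌋≡true⇒ (P w ≟ b) w∈b , q≡false

  red⇒mixed : ∀ {a b} → redEdge G P a b ≡ true → Mixed a b
  red⇒mixed {a} {b} red
    with ∧-not-not-true (not ⌊ a ≟ b ⌋) (blackEdge G P a b) (nonAdjacent G P a b) red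
  ... | notBlack , notNonAdjacent
    with pair-witness (adj G) notBlack | pair-witness (λ u w → not (adj G u w)) notNonAdjacent
  ... | u′ , w′ , u′∈a , w′∈b , nonEdge | u , w , u∈a , w∈b , edge =
    record { u∈a = u∈a ; u′∈a = u′∈a ; w∈b = w∈b ; w′∈b = w′∈b
           ; edge = not-injective edge ; non-edge = nonEdge }

  red-irreflexive : ∀ a → redEdge G P a a ≡ false
  red-irreflexive a rewrite ⌊⌋-true (a ≟ a) refl = refl

  mixed-sym : (∀ u w → adj G u w ≡ adj G w u) → ∀ {a b} → Mixed a b → Mixed b a
  mixed-sym adj-sym mixed = record
    { u∈a = w∈b ; u′∈a = w′∈b ; w∈b = u∈a ; w′∈b = u′∈a
    ; edge = trans (adj-sym _ _) edge ; non-edge = trans (adj-sym _ _) non-edge }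
    where open Mixed mixed

  injective⇒¬mixed : (∀ {u v} → P u ≡ P v → u ≡ v) → ∀ {a b} → ¬ Mixed a b
  injective⇒¬mixed P-injective record { u∈a = u∈a ; u′∈a = u′∈a ; w∈b = w∈b ; w′∈b = w′∈b
                                      ; edge = edge ; non-edge = non-edge }
    with refl ← P-injective (trans u∈a (sym u′∈a)) | refl ← P-injective (trans w∈b (sym w′∈b))
    with () ← trans (sym edge) non-edge

  redDegree-≡0 : ∀ {a} → (∀ {b} → ¬ Mixed a b) → redDegree G P a ≡ 0
  redDegree-≡0 {a} ¬mixed = cong length (filter-none (T? ∘ redEdge G P a)
    (All.universal (λ b red → ¬mixed (red⇒mixed {a} {b} (Equivalence.to T-≡ red))) (allFin m)))

  redDegree-≤-by-code : ∀ {a M} {Q : Fin m → Set} → Q a → (∀ {b} → Mixed a b → Q b) →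
                        (code : ∀ {x} → Q x → ℕ) →
                        (∀ {x y} (qx : Q x) (qy : Q y) → code qx ≡ code qy → x ≡ y) →
                        (∀ {x} (qx : Q x) → code qx ≤ M) → redDegree G P a ≤ M
  redDegree-≤-by-code {a} Qa mixed⇒Q =
    count-≤-by-code (redEdge G P a) a (red-irreflexive a) Qa (λ b red → mixed⇒Q (red⇒mixed red))

-- Contraction sequences from labellings

injective⇒surjective : ∀ {N} (g : Fin N → Fin N) → (∀ {u w} → g u ≡ g w → u ≡ w) → ∀ y → ∃ λ u → g u ≡ y
injective⇒surjective {suc N} g g-injective y with any? (λ u → g u ≟ y)
... | yes hit = hit
... | no miss = ⊥-elim (1+n≰n (injective⇒≤ {f = h} h-injective))
  where
  h : Fin (suc N) → Fin N
  h u = punchOut {i = y} {j = g u} (λ y≡gu → miss (u , sym y≡gu))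
  h-injective : ∀ {u w} → h u ≡ h w → u ≡ w
  h-injective {u} {w} eq =
    g-injective (punchOut-injective {i = y} (λ y≡gu → miss (u , sym y≡gu)) (λ y≡gw → miss (w , sym y≡gw)) eq)

JoinedBy : ∀ {X : Set} {l} → (X → Fin l) → Fin l → Fin l → X → X → Set
JoinedBy P a b u v = (P u ≡ P v) ⊎ ((P u ≡ a ⊎ P u ≡ b) × (P v ≡ a ⊎ P v ≡ b))

MergeOf : ∀ {X : Set} {k} → (X → Fin (suc (suc k))) → (X → Fin (suc k)) → Set
MergeOf {k = k} P₁ P₀ =
  Σ (Fin (suc (suc k))) λ a → Σ (Fin (suc (suc k))) λ b → ¬ (a ≡ b) ×
    (∀ u v → (P₀ u ≡ P₀ v → JoinedBy P₁ a b u v) × (JoinedBy P₁ a b u v → P₀ u ≡ P₀ v))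

module Relabelling {X : Set} {k} (P₁ : X → Fin (suc (suc k))) (P₀ : X → Fin (suc k))
                   {b : ℕ} (b<1+k : b < suc k) where

  RelabelsLast : X → Set
  RelabelsLast x = (toℕ (P₁ x) ≤ k × toℕ (P₀ x) ≡ toℕ (P₁ x)) ⊎ (toℕ (P₁ x) ≡ suc k × toℕ (P₀ x) ≡ b)

  last b′ : Fin (suc (suc k))
  last = Fin.fromℕ (suc k)
  b′   = Fin.fromℕ< (<-trans b<1+k (n<1+n (suc k)))

  toℕ-last : toℕ last ≡ suc k
  toℕ-last = toℕ-fromℕ (suc k)

  toℕ-b′ : toℕ b′ ≡ b
  toℕ-b′ = toℕ-fromℕ< (<-trans b<1+k (n<1+n (suc k)))

  last≢b′ : ¬ (last ≡ b′)
  last≢b′ eq = <⇒≢ b<1+k (sym (trans (sym toℕ-last) (trans (cong toℕ eq) toℕ-b′)))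

  ≤k⇒≢last : ∀ {x} → toℕ (P₁ x) ≤ k → P₁ x ≢ last
  ≤k⇒≢last ≤k eq = <-irrefl refl (subst (_≤ k) (trans (cong toℕ eq) toℕ-last) ≤k)

  ≡last⇒≡ : ∀ {x} → toℕ (P₁ x) ≡ suc k → P₁ x ≡ last
  ≡last⇒≡ eq = toℕ-injective (trans eq (sym toℕ-last))

  relabel-forward : ∀ {u v} → RelabelsLast u → RelabelsLast v → P₀ u ≡ P₀ v → JoinedBy P₁ last b′ u v
  relabel-forward (inj₁ (_ , u≡)) (inj₁ (_ , v≡)) eq = inj₁ (toℕ-injective (trans (sym u≡) (trans (cong toℕ eq) v≡)))
  relabel-forward (inj₁ (_ , u≡)) (inj₂ (v-last , v≡b)) eq =
    inj₂ (inj₂ (toℕ-injective (trans (sym u≡) (trans (cong toℕ eq) (trans v≡b (sym toℕ-b′))))) ,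
          inj₁ (≡last⇒≡ v-last))
  relabel-forward (inj₂ (u-last , u≡b)) (inj₁ (_ , v≡)) eq =
    inj₂ (inj₁ (≡last⇒≡ u-last) ,
          inj₂ (toℕ-injective (trans (sym v≡) (trans (cong toℕ (sym eq)) (trans u≡b (sym toℕ-b′))))))
  relabel-forward (inj₂ (u-last , _)) (inj₂ (v-last , _)) eq = inj₁ (toℕ-injective (trans u-last (sym v-last)))

  merged⇒b : ∀ {x} → RelabelsLast x → (P₁ x ≡ last ⊎ P₁ x ≡ b′) → toℕ (P₀ x) ≡ b
  merged⇒b (inj₂ (_ , ≡b))   _            = ≡b
  merged⇒b (inj₁ (≤k , _))   (inj₁ ≡last) = ⊥-elim (≤k⇒≢last ≤k ≡last)
  merged⇒b (inj₁ (_ , same)) (inj₂ ≡b′)   = trans same (trans (cong toℕ ≡b′) toℕ-b′)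

  relabel-backward : ∀ {u v} → RelabelsLast u → RelabelsLast v → JoinedBy P₁ last b′ u v → P₀ u ≡ P₀ v
  relabel-backward su sv (inj₂ (u∈ , v∈)) = toℕ-injective (trans (merged⇒b su u∈) (sym (merged⇒b sv v∈)))
  relabel-backward (inj₁ (_ , u≡)) (inj₁ (_ , v≡)) (inj₁ eq) = toℕ-injective (trans u≡ (trans (cong toℕ eq) (sym v≡)))
  relabel-backward (inj₁ (≤k , _)) (inj₂ (v-last , _)) (inj₁ eq) = ⊥-elim (≤k⇒≢last ≤k (trans eq (≡last⇒≡ v-last)))
  relabel-backward (inj₂ (u-last , _)) (inj₁ (≤k , _)) (inj₁ eq) = ⊥-elim (≤k⇒≢last ≤k (trans (sym eq) (≡last⇒≡ u-last)))
  relabel-backward (inj₂ (_ , u≡b)) (inj₂ (_ , v≡b)) (inj₁ _) = toℕ-injective (trans u≡b (sym v≡b))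

  merge-of-relabelling : (∀ x → RelabelsLast x) → MergeOf P₁ P₀
  merge-of-relabelling step =
    last , b′ , last≢b′ , λ u v → relabel-forward (step u) (step v) , relabel-backward (step u) (step v)

-- The elimination order

Pair : Set
Pair = ℕ × ℕ

module Elimination (n : ℕ) where

  Valid : Pair → Set
  Valid (c , x) = c < x × x < n

  offset : Pair → ℕ
  offset (c , x) = if ⌊ x ≟ℕ suc c ⌋ then 0 else n ∸ x

  -- Stage k keeps the pairs of rank ≤ k as names of parts; going to stage k the pair of
  -- rank k + 1 is merged into its parent.  In increasing rank, rows with larger c come
  -- first, and within row c the pair (c, c + 1) comes first.
  rank : Pair → ℕ
  rank (c , x) = triangle (n ∸ suc (suc c)) + offset (c , x)

  parent : Pair → Pair
  parent (c , x) = if ⌊ x ≟ℕ suc c ⌋ then (suc c , suc (suc c)) else (suc c , x)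

  offset-≤ : ∀ {c x} → Valid (c , x) → offset (c , x) ≤ n ∸ suc (suc c)
  offset-≤ {c} {x} (c<x , _) with x ≟ℕ suc c
  ... | yes _   = z≤n
  ... | no x≢1+c = ∸-monoʳ-≤ n (≤∧≢⇒< c<x (x≢1+c ∘ sym))

  rank-<-row : ∀ {c x} → Valid (c , x) → rank (c , x) < triangle (n ∸ suc c)
  rank-<-row {c} {x} v@(c<x , x<n) rewrite ∸-suc (≤-<-trans c<x x<n) =
    s≤s (subst (_≤ r + triangle r) (+-comm (offset (c , x)) (triangle r))
               (+-monoˡ-≤ (triangle r) (offset-≤ v)))
    where r = n ∸ suc (suc c)

  rank-< : ∀ {p} → Valid p → rank p < triangle (n ∸ 1)
  rank-< v = <-≤-trans (rank-<-row v) (triangle-mono-≤ (∸-monoʳ-≤ n (s≤s z≤n)))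

  rank-antitone : ∀ {c x c′ x′} → Valid (c , x) → Valid (c′ , x′) → c < c′ → rank (c′ , x′) < rank (c , x)
  rank-antitone {c} {x} {c′} v v′ c<c′ = <-≤-trans (rank-<-row v′)
    (≤-trans (triangle-mono-≤ (∸-monoʳ-≤ n (s≤s c<c′))) (m≤m+n _ (offset (c , x))))

  rank-row-start : ∀ {i j} → Valid (i , j) → rank (i , suc i) ≤ rank (i , j)
  rank-row-start {i} _ rewrite ⌊⌋-true (suc i ≟ℕ suc i) refl =
    ≤-trans (≤-reflexive (+-identityʳ _)) (m≤m+n _ _)

  offset-injective : ∀ {c x x′} → Valid (c , x) → Valid (c , x′) → offset (c , x) ≡ offset (c , x′) → x ≡ x′
  offset-injective {c} {x} {x′} (_ , x<n) (_ , x′<n) eq with x ≟ℕ suc c | x′ ≟ℕ suc c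
  ... | yes x≡ | yes x′≡ = trans x≡ (sym x′≡)
  ... | yes _  | no _    = ⊥-elim (m>n⇒m∸n≢0 x′<n (sym eq))
  ... | no _   | yes _   = ⊥-elim (m>n⇒m∸n≢0 x<n eq)
  ... | no _   | no _    = ∸-cancelˡ-≡ (<⇒≤ x<n) (<⇒≤ x′<n) eq

  rank-injective : ∀ {p q} → Valid p → Valid q → rank p ≡ rank q → p ≡ q
  rank-injective {c , x} {c′ , x′} v v′ eq with <-cmp c c′
  ... | tri< c<c′ _ _ = ⊥-elim (<⇒≢ (rank-antitone v v′ c<c′) (sym eq))
  ... | tri> _ _ c>c′ = ⊥-elim (<⇒≢ (rank-antitone v′ v c>c′) eq)
  ... | tri≈ _ refl _ = cong (c ,_) (offset-injective v v′ (+-cancelˡ-≡ (triangle (n ∸ suc (suc c))) _ _ eq))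

  parent-row : ∀ c x → proj₁ (parent (c , x)) ≡ suc c
  parent-row c x with x ≟ℕ suc c
  ... | yes _ = refl
  ... | no _  = refl

  parent-valid : ∀ {c x} → Valid (c , x) → 0 < rank (c , x) → Valid (parent (c , x))
  parent-valid {c} {x} (c<x , x<n) 0<rank with x ≟ℕ suc c
  ... | no x≢1+c = ≤∧≢⇒< c<x (x≢1+c ∘ sym) , x<n
  ... | yes refl with suc (suc c) <ℕ? n
  ...   | yes 2+c<n = n<1+n (suc c) , 2+c<n
  ...   | no 2+c≮n  = ⊥-elim (<⇒≢ 0<rank (sym (trans (+-identityʳ _)
                                              (cong triangle (m≤n⇒m∸n≡0 (≮⇒≥ 2+c≮n))))))

  parent-rank-< : ∀ {p} → Valid p → 0 < rank p → Valid (parent p) × rank (parent p) < rank p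
  parent-rank-< {c , x} v 0<rank = v′ , rank-antitone v v′ (subst (c <_) (sym (parent-row c x)) (n<1+n c))
    where v′ = parent-valid v 0<rank

  adjacent : Pair → Pair → Bool
  adjacent (c , x) (y , z) = ((δ c y + δ c z) + (δ x y + δ x z)) ≡ᵇ 1

  adjacent-sym : ∀ p q → adjacent p q ≡ adjacent q p
  adjacent-sym (c , x) (y , z) = cong (_≡ᵇ 1) (begin
    (δ c y + δ c z) + (δ x y + δ x z) ≡⟨ interchange (δ c y) (δ c z) (δ x y) (δ x z) ⟩
    (δ c y + δ x y) + (δ c z + δ x z) ≡⟨ cong₂ _+_ (cong₂ _+_ (δ-sym c y) (δ-sym x y))
                                                   (cong₂ _+_ (δ-sym c z) (δ-sym x z)) ⟩
    (δ y c + δ y x) + (δ z c + δ z x) ∎)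
    where open ≡-Reasoning

  parent-preserves-adjacent : ∀ {c x y z} → suc c < y → y < z → (x ≡ suc c → suc (suc c) < y) →
                              adjacent (c , x) (y , z) ≡ adjacent (parent (c , x)) (y , z)
  parent-preserves-adjacent {c} {x} {y} {z} 1+c<y y<z far with x ≟ℕ suc c
  ... | no _     rewrite δ-< (<⇒≤ 1+c<y) | δ-< (<-trans (<⇒≤ 1+c<y) y<z)
                       | δ-< 1+c<y | δ-< (<-trans 1+c<y y<z) = refl
  ... | yes refl rewrite δ-< (<⇒≤ 1+c<y) | δ-< (<-trans (<⇒≤ 1+c<y) y<z)
                       | δ-< 1+c<y | δ-< (<-trans 1+c<y y<z)
                       | δ-< (far refl) | δ-< (<-trans (far refl) y<z) = refl

  parent-preserves-adjacent-01 : ∀ {x} → 1 < x → adjacent (0 , x) (0 , 1) ≡ adjacent (parent (0 , x)) (0 , 1)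
  parent-preserves-adjacent-01 {x} 1<x with x ≟ℕ 1
  ... | yes refl = ⊥-elim (<-irrefl refl 1<x)
  ... | no _     rewrite δ-refl 0 | δ-< {0} {1} (s≤s z≤n) | δ-sym 1 0 | δ-< {0} {1} (s≤s z≤n) | δ-refl 1 = refl

  -- In row 0 the pairs (0, 1) and (0, 2) are left out: (0, 2) is merged first, and (0, 1)
  -- stays a part without red edges.  Otherwise the count below would exceed 2(n − 3) + 1.
  activeFrom : ℕ → ℕ
  activeFrom zero    = 3
  activeFrom (suc i) = suc (suc i)

  Active : ℕ → Pair → Set
  Active i (c , x) = (c ≡ i × activeFrom i ≤ x) ⊎ c ≡ suc i

  activeFrom-≤-or-01 : ∀ {i z} → i < z → (i ≡ 0 → z ≢ 2) → activeFrom i ≤ z ⊎ (i ≡ 0 × z ≡ 1)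
  activeFrom-≤-or-01 {suc i} i<z _                = inj₁ i<z
  activeFrom-≤-or-01 {zero} {1} _ _               = inj₂ (refl , refl)
  activeFrom-≤-or-01 {zero} {2} _ z≢2             = ⊥-elim (z≢2 refl refl)
  activeFrom-≤-or-01 {zero} {suc (suc (suc _))} _ _ = inj₁ (s≤s (s≤s (s≤s z≤n)))

  activeIndex : ∀ {i p} → Active i p → ℕ
  activeIndex {i} {c , x} (inj₁ _) = x ∸ activeFrom i
  activeIndex {i} {c , x} (inj₂ _) = (n ∸ activeFrom i) + (x ∸ suc (suc i))

  activeIndex-injective : ∀ {i p q} → Valid p → Valid q → (a : Active i p) (b : Active i q) →
                          activeIndex a ≡ activeIndex b → p ≡ q
  activeIndex-injective _ _ (inj₁ (refl , k≤x)) (inj₁ (refl , k≤x′)) eq =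
    cong (_ ,_) (∸-cancelʳ-≡ k≤x k≤x′ eq)
  activeIndex-injective (_ , x<n) _ (inj₁ (refl , k≤x)) (inj₂ refl) eq =
    ⊥-elim (<⇒≢ (<-≤-trans (∸-monoˡ-< x<n k≤x) (m≤m+n _ _)) eq)
  activeIndex-injective _ (_ , x′<n) (inj₂ refl) (inj₁ (refl , k≤x′)) eq =
    ⊥-elim (<⇒≢ (<-≤-trans (∸-monoˡ-< x′<n k≤x′) (m≤m+n _ _)) (sym eq))
  activeIndex-injective (i<x , _) (i<x′ , _) (inj₂ refl) (inj₂ refl) eq =
    cong (_ ,_) (∸-cancelʳ-≡ i<x i<x′ (+-cancelˡ-≡ _ _ _ eq))

  activeIndex-≤ : ∀ {i p} → Valid p → (a : Active i p) → activeIndex a ≤ 2 * (n ∸ 3)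
  activeIndex-≤ {i} {_ , x} (_ , x<n) (inj₁ (refl , k≤x)) = begin
    x ∸ activeFrom i    ≤⟨ ∸-monoʳ-≤ x (activeFrom-≥2 i) ⟩
    x ∸ 2               ≤⟨ ∸-monoˡ-≤ 3 x<n ⟩
    n ∸ 3               ≤⟨ m≤m+n (n ∸ 3) _ ⟩
    2 * (n ∸ 3)         ∎
    where
    open ≤-Reasoning
    activeFrom-≥2 : ∀ i → 2 ≤ activeFrom i
    activeFrom-≥2 zero    = s≤s (s≤s z≤n)
    activeFrom-≥2 (suc i) = s≤s (s≤s z≤n)
  activeIndex-≤ {zero} {_ , x} (_ , x<n) (inj₂ refl) = begin
    (n ∸ 3) + (x ∸ 2)   ≤⟨ +-monoʳ-≤ (n ∸ 3) (∸-monoˡ-≤ 3 x<n) ⟩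
    (n ∸ 3) + (n ∸ 3)   ≡⟨ cong ((n ∸ 3) +_) (+-identityʳ (n ∸ 3)) ⟨
    2 * (n ∸ 3)         ∎
    where open ≤-Reasoning
  activeIndex-≤ {suc i} {_ , x} (2+i<x , x<n) (inj₂ refl) = begin
    (n ∸ suc (suc i)) + (x ∸ suc (suc (suc i)))
      ≤⟨ +-mono-≤ (∸-monoʳ-≤ n (s≤s (s≤s z≤n))) (∸-monoʳ-≤ x (s≤s (s≤s (s≤s z≤n)))) ⟩
    (n ∸ 2) + (x ∸ 3)   ≤⟨ +-monoʳ-≤ (n ∸ 2) (∸-monoˡ-≤ 4 x<n) ⟩
    (n ∸ 2) + (n ∸ 4)   ≡⟨ ∸2+∸4≡2*∸3 (≤-<-trans (≤-trans (s≤s (s≤s (s≤s z≤n))) 2+i<x) x<n) ⟩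
    2 * (n ∸ 3)         ∎
    where open ≤-Reasoning

  -- The name of the part of p at stage k.  The first argument is fuel; rank p is
  -- enough, since ranks decrease along parents.
  descend : ℕ → ℕ → Pair → Pair
  descend zero    k p = p
  descend (suc f) k p with rank p ≤? k
  ... | yes _ = p
  ... | no _  = descend f k (parent p)

  descend-alive : ∀ f {k p} → rank p ≤ k → descend f k p ≡ p
  descend-alive zero    _    = refl
  descend-alive (suc f) {k} {p} rank≤k with rank p ≤? k
  ... | yes _ = refl
  ... | no rank≰k = ⊥-elim (rank≰k rank≤k)

  descend-dead : ∀ f {k p} → k < rank p → descend (suc f) k p ≡ descend f k (parent p)
  descend-dead f {k} {p} k<rank with rank p ≤? k
  ... | yes rank≤k = ⊥-elim (<⇒≱ k<rank rank≤k)
  ... | no _       = refl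

  private
    parent-of-dead : ∀ {k p} → Valid p → ¬ rank p ≤ k → Valid (parent p) × rank (parent p) < rank p
    parent-of-dead v rank≰k = parent-rank-< v (≤-<-trans z≤n (≰⇒> rank≰k))

  descend-valid : ∀ f k {p} → Valid p → rank p ≤ f → Valid (descend f k p) × rank (descend f k p) ≤ k
  descend-valid zero    k v rank≤0 = v , ≤-trans rank≤0 z≤n
  descend-valid (suc f) k {p} v rank≤f with rank p ≤? k
  ... | yes rank≤k = v , rank≤k
  ... | no rank≰k  =
    let v′ , rank′< = parent-of-dead v rank≰k in descend-valid f k v′ (≤-pred (≤-trans rank′< rank≤f))

  descend-suc : ∀ f k {p} → Valid p → rank p ≤ f → descend f k p ≡ descend 1 k (descend f (suc k) p)
  descend-suc zero    k v rank≤0 = sym (descend-alive 1 (≤-trans rank≤0 z≤n))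
  descend-suc (suc f) k {p} v rank≤f with rank p ≤? suc k
  ... | yes rank≤1+k with rank p ≤? k
  ...   | yes _      = refl
  ...   | no rank≰k  = descend-alive f (≤-pred (≤-trans (proj₂ (parent-of-dead v rank≰k)) rank≤1+k))
  descend-suc (suc f) k {p} v rank≤f | no rank≰1+k =
    let v′ , rank′< = parent-of-dead v rank≰1+k in
    trans (descend-dead f (<-trans (n<1+n k) (≰⇒> rank≰1+k)))
          (descend-suc f k v′ (≤-pred (≤-trans rank′< rank≤f)))

  descend-to-childless : ∀ f k {p q} → Valid p → rank p ≤ f →
                         (∀ {w} → Valid w → k < rank w → parent w ≢ q) → descend f k p ≡ q → p ≡ q
  descend-to-childless zero    k v rank≤f childless eq = eq
  descend-to-childless (suc f) k {p} v rank≤f childless eq with rank p ≤? k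
  ... | yes _     = eq
  ... | no rank≰k =
    let v′ , rank′< = parent-of-dead v rank≰k in
    ⊥-elim (childless v (≰⇒> rank≰k) (descend-to-childless f k v′ (≤-pred (≤-trans rank′< rank≤f)) childless eq))

  descend-invariant : ∀ {B : Set} (g : Pair → B) f k {p} → Valid p → rank p ≤ f →
                      (∀ {w} → Valid w → k < rank w → g w ≡ g (parent w)) → g p ≡ g (descend f k p)
  descend-invariant g zero    k v rank≤f inv = refl
  descend-invariant g (suc f) k {p} v rank≤f inv with rank p ≤? k
  ... | yes _     = refl
  ... | no rank≰k =
    let v′ , rank′< = parent-of-dead v rank≰k in
    trans (inv v (≰⇒> rank≰k)) (descend-invariant g f k v′ (≤-pred (≤-trans rank′< rank≤f)) inv)

  module Stage (k : ℕ) {i j} (v-ij : Valid (i , j)) (rank-ij : rank (i , j) ≡ k) where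

    -- Names of parts that are single vertices without red edges at stage k.
    Special : Pair → Set
    Special (y , z) = suc (suc i) ≤ y ⊎ (i ≡ 0 × y ≡ 0 × z ≡ 1)

    live-row-≥ : ∀ {y z} → Valid (y , z) → rank (y , z) ≤ k → i ≤ y
    live-row-≥ {y} {z} v rank≤k with i ≤? y
    ... | yes i≤y = i≤y
    ... | no i≰y  = ⊥-elim (<⇒≱ (rank-antitone v v-ij (≰⇒> i≰y)) (subst (rank (y , z) ≤_) (sym rank-ij) rank≤k))

    dead-row-≤ : ∀ {c x} → Valid (c , x) → k < rank (c , x) → c ≤ i × (c ≡ i → x ≢ suc i)
    dead-row-≤ {c} {x} v k<rank = c≤i , not-row-start
      where
      c≤i : c ≤ i
      c≤i with c ≤? i
      ... | yes c≤i = c≤i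
      ... | no c≰i  = ⊥-elim (<⇒≱ k<rank (subst (rank (c , x) ≤_) rank-ij (<⇒≤ (rank-antitone v-ij v (≰⇒> c≰i)))))
      not-row-start : c ≡ i → x ≢ suc i
      not-row-start refl refl = <⇒≱ k<rank (subst (rank (i , suc i) ≤_) rank-ij (rank-row-start v-ij))

    classify : ∀ {y z} → Valid (y , z) → rank (y , z) ≤ k → k < rank (0 , 2) → Active i (y , z) ⊎ Special (y , z)
    classify {y} {z} v rank≤k k<rank02 with m≤n⇒m<n∨m≡n (live-row-≥ v rank≤k)
    ... | inj₁ i<y with y ≟ℕ suc i
    ...   | yes y≡1+i = inj₁ (inj₂ y≡1+i)
    ...   | no y≢1+i  = inj₂ (inj₁ (≤∧≢⇒< i<y (y≢1+i ∘ sym)))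
    classify {y} {z} (y<z , _) rank≤k k<rank02 | inj₂ refl
      with activeFrom-≤-or-01 y<z (λ { refl refl → <⇒≱ k<rank02 rank≤k })
    ... | inj₁ from≤z                = inj₁ (inj₁ (refl , from≤z))
    ... | inj₂ (refl , refl)         = inj₂ (inj₂ (refl , refl , refl))

    special-childless : ∀ {q w} → Special q → Valid w → k < rank w → parent w ≢ q
    special-childless {y , z} {c , x} (inj₁ 2+i≤y) v k<rank parent≡q =
      <⇒≱ (≤-pred (subst (suc (suc i) ≤_) (trans (sym (cong proj₁ parent≡q)) (parent-row c x)) 2+i≤y))
          (proj₁ (dead-row-≤ v k<rank))
    special-childless {y , z} {c , x} (inj₂ (_ , refl , _)) v k<rank parent≡q
      with () ← trans (sym (parent-row c x)) (cong proj₁ parent≡q)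

    special-invariant : ∀ {q w} → Valid q → Special q → Valid w → k < rank w →
                        adjacent w q ≡ adjacent (parent w) q
    special-invariant {y , z} {c , x} (y<z , _) (inj₁ 2+i≤y) v k<rank =
      parent-preserves-adjacent (≤-trans (s≤s (s≤s c≤i)) 2+i≤y) y<z far
      where
      c≤i : c ≤ i
      c≤i = proj₁ (dead-row-≤ v k<rank)
      far : x ≡ suc c → suc (suc c) < y
      far x≡1+c with m≤n⇒m<n∨m≡n c≤i
      ... | inj₁ c<i = ≤-trans (s≤s (s≤s c<i)) 2+i≤y
      ... | inj₂ c≡i = ⊥-elim (proj₂ (dead-row-≤ v k<rank) c≡i (trans x≡1+c (cong suc c≡i)))
    special-invariant {_ , _} {c , x} _ (inj₂ (refl , refl , refl)) v@(c<x , _) k<rank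
      with proj₁ (dead-row-≤ v k<rank)
    ... | z≤n = parent-preserves-adjacent-01 (≤∧≢⇒< c<x (λ 1≡x → proj₂ (dead-row-≤ v k<rank) refl (sym 1≡x)))

-- The contraction sequence of J(n,2)

module JohnsonContraction (t : ℕ) where

  n : ℕ
  n = 3 + t

  open Elimination n

  G : Graph
  G = Johnson2 n

  V : ℕ
  V = N G

  -- Opaque, since unfolding pairs n makes type checking blow up.
  opaque
    vertex : Fin V → Pair
    vertex u = toℕ (proj₁ (lookup (pairs n) u)) , toℕ (proj₂ (lookup (pairs n) u))

    vertex-valid : ∀ u → Valid (vertex u)
    vertex-valid u = All.lookup (pairs-ordered n) (∈-lookup u) , toℕ<n _

    vertex-injective : ∀ {u w} → vertex u ≡ vertex w → u ≡ w
    vertex-injective {u} {w} eq = lookup-injective (pairs n) (pairs-unique n) u w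
      (cong₂ _,_ (toℕ-injective (cong proj₁ eq)) (toℕ-injective (cong proj₂ eq)))

    adj-vertex : ∀ u w → adj G u w ≡ adjacent (vertex u) (vertex w)
    adj-vertex u w = cong (_≡ᵇ 1) (interSize-formula _ _ _ _ (ordered⇒≢ u) (ordered⇒≢ w))
      where
      ordered⇒≢ : ∀ u → proj₁ (lookup (pairs n) u) ≢ proj₂ (lookup (pairs n) u)
      ordered⇒≢ u eq = <⇒≢ (All.lookup (pairs-ordered n) (∈-lookup u)) (cong toℕ eq)

  adj-sym : ∀ u w → adj G u w ≡ adj G w u
  adj-sym u w = trans (adj-vertex u w) (trans (adjacent-sym (vertex u) (vertex w)) (sym (adj-vertex w u)))

  V≡ : V ≡ triangle (2 + t)
  V≡ = length-pairs (2 + t)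

  rank-vertex-< : ∀ u → rank (vertex u) < V
  rank-vertex-< u = subst (rank (vertex u) <_) (sym V≡) (rank-< (vertex-valid u))

  rank-vertex-injective : ∀ {u w} → rank (vertex u) ≡ rank (vertex w) → u ≡ w
  rank-vertex-injective eq = vertex-injective (rank-injective (vertex-valid _) (vertex-valid _) eq)

  vertex-of-rank : ∀ {r} → r < V → ∃ λ u → rank (vertex u) ≡ r
  vertex-of-rank {r} r<V =
    let u , eq = injective⇒surjective rank-as-Fin rank-as-Fin-injective (Fin.fromℕ< r<V)
    in u , fromℕ<-injective (rank (vertex u)) r (rank-vertex-< u) r<V eq
    where
    rank-as-Fin : Fin V → Fin V
    rank-as-Fin u = Fin.fromℕ< (rank-vertex-< u)
    rank-as-Fin-injective : ∀ {u w} → rank-as-Fin u ≡ rank-as-Fin w → u ≡ w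
    rank-as-Fin-injective {u} {w} eq =
      rank-vertex-injective
        (fromℕ<-injective (rank (vertex u)) (rank (vertex w)) (rank-vertex-< u) (rank-vertex-< w) eq)

  root : ℕ → Fin V → Pair
  root k u = descend (triangle (2 + t)) k (vertex u)

  rank-vertex-≤-fuel : ∀ u → rank (vertex u) ≤ triangle (2 + t)
  rank-vertex-≤-fuel u = <⇒≤ (rank-< (vertex-valid u))

  root-valid : ∀ k u → Valid (root k u) × rank (root k u) ≤ k
  root-valid k u = descend-valid _ k (vertex-valid u) (rank-vertex-≤-fuel u)

  root-alive : ∀ {k u} → rank (vertex u) ≤ k → root k u ≡ vertex u
  root-alive = descend-alive _

  root-suc : ∀ k u → root k u ≡ descend 1 k (root (suc k) u)
  root-suc k u = descend-suc _ k (vertex-valid u) (rank-vertex-≤-fuel u)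

  opaque
    part : (k : ℕ) → Fin V → Fin (suc k)
    part k u = Fin.fromℕ< (s≤s (proj₂ (root-valid k u)))

    toℕ-part : ∀ k u → toℕ (part k u) ≡ rank (root k u)
    toℕ-part k u = toℕ-fromℕ< (s≤s (proj₂ (root-valid k u)))

  part-alive : ∀ {k u} → rank (vertex u) ≤ k → toℕ (part k u) ≡ rank (vertex u)
  part-alive {k} {u} rank≤k = trans (toℕ-part k u) (cong rank (root-alive rank≤k))

  part-surjective : ∀ k → suc k ≤ V → Surjective _≡_ _≡_ (part k)
  part-surjective k k<V y =
    let u , rank≡y = vertex-of-rank (<-≤-trans (toℕ<n y) k<V)
    in u , λ { refl → toℕ-injective (trans (part-alive (subst (_≤ k) (sym rank≡y) (≤-pred (toℕ<n y)))) rank≡y) }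

  part-discrete : ∀ k → suc k ≡ V → ∀ {u w} → part k u ≡ part k w → u ≡ w
  part-discrete k 1+k≡V {u} {w} eq =
    rank-vertex-injective (trans (sym (part-alive (alive u))) (trans (cong toℕ eq) (part-alive (alive w))))
    where
    alive : ∀ u → rank (vertex u) ≤ k
    alive u = ≤-pred (subst (rank (vertex u) <_) (sym 1+k≡V) (rank-vertex-< u))

  part-merge : ∀ k → suc (suc k) ≤ V → MergeOf (part (suc k)) (part k)
  part-merge k 2+k≤V = merge-of-relabelling step
    where
    v₀ : Fin V
    v₀ = proj₁ (vertex-of-rank 2+k≤V)
    rank-v₀ : rank (vertex v₀) ≡ suc k
    rank-v₀ = proj₂ (vertex-of-rank 2+k≤V)
    parent-v₀ : Valid (parent (vertex v₀)) × rank (parent (vertex v₀)) < rank (vertex v₀)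
    parent-v₀ = parent-rank-< (vertex-valid v₀) (subst (0 <_) (sym rank-v₀) (s≤s z≤n))
    b<1+k : rank (parent (vertex v₀)) < suc k
    b<1+k = subst (rank (parent (vertex v₀)) <_) rank-v₀ (proj₂ parent-v₀)

    open Relabelling (part (suc k)) (part k) b<1+k

    step : ∀ u → RelabelsLast u
    step u = step-by (rank (root (suc k) u) ≤? k)
      where
      step-by : Dec (rank (root (suc k) u) ≤ k) → RelabelsLast u
      step-by (yes rank≤k) =
        inj₁ (subst (_≤ k) (sym (toℕ-part (suc k) u)) rank≤k ,
              trans (toℕ-part k u)
                    (trans (cong rank (trans (root-suc k u) (descend-alive 1 {p = root (suc k) u} rank≤k)))
                           (sym (toℕ-part (suc k) u))))
      step-by (no rank≰k) =
        inj₂ (trans (toℕ-part (suc k) u) rank≡1+k ,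
              trans (toℕ-part k u) (cong rank (trans (root-suc k u)
                    (trans (descend-dead 0 {p = root (suc k) u} (≰⇒> rank≰k)) (cong parent root≡v₀)))))
        where
        rank≡1+k : rank (root (suc k) u) ≡ suc k
        rank≡1+k = ≤-antisym (proj₂ (root-valid (suc k) u)) (≰⇒> rank≰k)
        root≡v₀ : root (suc k) u ≡ vertex v₀
        root≡v₀ = rank-injective (proj₁ (root-valid (suc k) u)) (vertex-valid v₀) (trans rank≡1+k (sym rank-v₀))

  contraction : ContractionSequence G
  contraction = record
    { Seq      = part
    ; parts    = part-surjective
    ; discrete = λ k 1+k≡V → part-discrete k 1+k≡V
    ; merge    = part-merge
    }

  module Width (k : ℕ) (2+k≤V : suc (suc k) ≤ V) where

    k<V : k < V
    k<V = <-trans (n<1+n k) 2+k≤V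

    current : Fin V
    current = proj₁ (vertex-of-rank k<V)

    i j : ℕ
    i = proj₁ (vertex current)
    j = proj₂ (vertex current)

    open Stage k {i} {j} (vertex-valid current) (proj₂ (vertex-of-rank k<V))

    rep : Fin (suc k) → Pair
    rep ℓ = vertex (proj₁ (vertex-of-rank (<-≤-trans (toℕ<n ℓ) k<V)))

    rank-rep : ∀ ℓ → rank (rep ℓ) ≡ toℕ ℓ
    rank-rep ℓ = proj₂ (vertex-of-rank (<-≤-trans (toℕ<n ℓ) k<V))

    rep-valid : ∀ ℓ → Valid (rep ℓ)
    rep-valid ℓ = vertex-valid _

    rep-injective : ∀ {ℓ ℓ′} → rep ℓ ≡ rep ℓ′ → ℓ ≡ ℓ′
    rep-injective {ℓ} {ℓ′} eq = toℕ-injective (trans (sym (rank-rep ℓ)) (trans (cong rank eq) (rank-rep ℓ′)))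

    root≡rep : ∀ {u ℓ} → part k u ≡ ℓ → root k u ≡ rep ℓ
    root≡rep {u} {ℓ} refl = rank-injective (proj₁ (root-valid k u)) (rep-valid ℓ)
      (trans (sym (toℕ-part k u)) (sym (rank-rep ℓ)))

    -- (0, 2) has the largest rank, V − 1.
    k<rank02 : k < rank (0 , 2)
    k<rank02 = ≤-pred (subst (suc (suc k) ≤_) (trans V≡ (cong suc (+-comm (suc t) (triangle (suc t))))) 2+k≤V)

    active-or-special : ∀ ℓ → Active i (rep ℓ) ⊎ Special (rep ℓ)
    active-or-special ℓ = classify (rep-valid ℓ) (subst (_≤ k) (sym (rank-rep ℓ)) (≤-pred (toℕ<n ℓ))) k<rank02

    adj-to-special : ∀ {a b u w} → Special (rep a) → part k u ≡ a → part k w ≡ b →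
                     adj G u w ≡ adjacent (rep b) (rep a)
    adj-to-special {a} {b} {u} {w} special u∈a w∈b = begin
      adj G u w                            ≡⟨ adj-vertex u w ⟩
      adjacent (vertex u) (vertex w)       ≡⟨ cong (λ q → adjacent q (vertex w)) u≡rep ⟩
      adjacent (rep a) (vertex w)          ≡⟨ adjacent-sym (rep a) (vertex w) ⟩
      adjacent (vertex w) (rep a)          ≡⟨ descend-invariant (λ q → adjacent q (rep a)) _ k (vertex-valid w)
                                                (rank-vertex-≤-fuel w) (special-invariant (rep-valid a) special) ⟩
      adjacent (root k w) (rep a)          ≡⟨ cong (λ q → adjacent q (rep a)) (root≡rep w∈b) ⟩
      adjacent (rep b) (rep a)             ∎
      where
      open ≡-Reasoning
      u≡rep : vertex u ≡ rep a
      u≡rep = descend-to-childless _ k (vertex-valid u) (rank-vertex-≤-fuel u)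
                                   (special-childless special) (root≡rep u∈a)

    special-¬mixed : ∀ {a b} → Special (rep a) → ¬ Mixed G (part k) a b
    special-¬mixed {a} {b} special mixed = true≢false (begin
      true                      ≡⟨ edge ⟨
      adj G u w                 ≡⟨ adj-to-special special u∈a w∈b ⟩
      adjacent (rep b) (rep a)  ≡⟨ adj-to-special special u′∈a w′∈b ⟨
      adj G u′ w′               ≡⟨ non-edge ⟩
      false                     ∎)
      where
      open Mixed mixed
      open ≡-Reasoning
      true≢false : true ≢ false
      true≢false ()

    mixed⇒active : ∀ {a b} → Mixed G (part k) a b → Active i (rep b)
    mixed⇒active {b = b} mixed =
      [ id , (λ special → ⊥-elim (special-¬mixed special (mixed-sym G (part k) adj-sym mixed))) ]′
      (active-or-special b)

    redDegree-≤ : ∀ a → redDegree G (part k) a ≤ 2 * t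
    redDegree-≤ a = [ bound-active , bound-special ]′ (active-or-special a)
      where
      bound-special : Special (rep a) → redDegree G (part k) a ≤ 2 * t
      bound-special special = ≤-trans (≤-reflexive (redDegree-≡0 G (part k) (special-¬mixed special))) z≤n
      bound-active : Active i (rep a) → redDegree G (part k) a ≤ 2 * t
      bound-active active = redDegree-≤-by-code G (part k) active mixed⇒active
        (λ {ℓ} → activeIndex {i} {rep ℓ})
        (λ {ℓ} {ℓ′} act act′ eq → rep-injective (activeIndex-injective (rep-valid ℓ) (rep-valid ℓ′) act act′ eq))
        (λ {ℓ} → activeIndex-≤ (rep-valid ℓ))

  width : WidthAtMost G contraction (2 * t)
  width k k<V a = [ (λ 2+k≤V → Width.redDegree-≤ k 2+k≤V a) , bound-when-discrete ]′ (m≤n⇒m<n∨m≡n k<V)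
    where
    bound-when-discrete : suc k ≡ V → redDegree G (part k) a ≤ 2 * t
    bound-when-discrete 1+k≡V = ≤-trans (≤-reflexive (redDegree-≡0 G (part k)
                             (λ {b} → injective⇒¬mixed G (part k) (part-discrete k 1+k≡V) {a} {b}))) z≤n

lemma4p3 : ∀ (n : ℕ) → 3 ≤ n → TwwAtMost (Johnson2 n) (2 * (n ∸ 3))
lemma4p3 (suc (suc (suc t))) (s≤s (s≤s (s≤s _))) = contraction , width
  where open JohnsonContraction t
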